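{- Let $G$ be a group and $H \leq A \leq L\leq G$. If $A$ is a total perfect code of $(G,H)$, then $A$ is a total perfect code of $(L,H)$.
   Context: All groups are finite. For a group $G$, a subgroup $H\leq G$ and a subset $U\subseteq G$ which is a union of double cosets of $H$ with $H\cap U=\emptyset$ and $U^{ -1}=U$, the coset graph $\mathrm{Cos}(G,H,U)$ has as vertex set the set of left cosets of $H$ in $G$, with $g_1H$ and $g_2H$ adjacent iff $g_1^{ -1}g_2\in U$. A total perfect code in a graph is a set $C$ of vertices such that every vertex is adjacent to exactly one vertex of $C$. For $H\leq A\leq G$, $A$ is called a total perfect code of the pair $(G,H)$ if there is a coset graph $\mathrm{Cos}(G,H,U)$ in which the set $\{aH: a\in A\}$ of left cosets of $H$ contained in $A$ is a total perfect code. -}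

module Defs where

open import Level using (Level; _⊔_; suc; Lift)
open import Algebra.Bundles using (Group)
open import Relation.Unary using (Pred; _⊆_)
open import Data.Product using (Σ; _×_; Σ-syntax)
open import Data.Nat using (ℕ)
open import Data.Fin using (Fin)
open import Data.Unit using (⊤)
open import Data.Empty using (⊥)

module _ {c ℓ : Level} (G : Group c ℓ) where
  open Group G

  IsFinite : Set (c ⊔ ℓ)
  IsFinite = Σ ℕ λ n → Σ (Fin n → Carrier) λ f → ∀ x → Σ (Fin n) λ i → f i ≈ x

  Respects≈ : ∀ {p} → Pred Carrier p → Set (c ⊔ ℓ ⊔ p)
  Respects≈ P = ∀ {x y} → x ≈ y → P x → P y

  Full : ∀ {p} → Pred Carrier p
  Full {p} = λ _ → Lift p ⊤

  record IsSubgroup {p} (H : Pred Carrier p) : Set (c ⊔ ℓ ⊔ p) where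
    field
      resp : Respects≈ H
      ε∈   : H ε
      ∙∈   : ∀ {x y} → H x → H y → H (x ∙ y)
      ⁻¹∈  : ∀ {x} → H x → H (x ⁻¹)

  -- U is an admissible connection set for the coset graph Cos(K,H,U),
  -- where K ≤ G is the ambient group (K = Full for G itself):
  -- U ⊆ K, U is a union of double cosets HuH, H ∩ U = ∅ and U⁻¹ = U.
  record IsCosetGraphSet {p} (K H U : Pred Carrier p) : Set (c ⊔ ℓ ⊔ p) where
    field
      resp     : Respects≈ U
      ⊆K       : U ⊆ K
      double   : ∀ {h u h′} → H h → U u → H h′ → U ((h ∙ u) ∙ h′)
      disjoint : ∀ {x} → H x → U x → ⊥
      inv⊆     : ∀ {u} → U u → U (u ⁻¹)
      inv⊇     : ∀ {u} → U (u ⁻¹) → U u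

  -- Vertices of Cos(K,H,U): left cosets gH, g ∈ K, represented by g.
  -- gH = g′H  iff  g⁻¹g′ ∈ H;  g₁H ~ g₂H  iff  g₁⁻¹g₂ ∈ U.
  SameCoset : ∀ {p} → Pred Carrier p → Carrier → Carrier → Set p
  SameCoset H g g′ = H ((g ⁻¹) ∙ g′)

  Adjacent : ∀ {p} → Pred Carrier p → Carrier → Carrier → Set p
  Adjacent U g₁ g₂ = U ((g₁ ⁻¹) ∙ g₂)

  -- {aH : a ∈ A} is a total perfect code of Cos(K,H,U): every vertex gH
  -- (g ∈ K) is adjacent to exactly one vertex of the form aH, a ∈ A.
  IsTotalPerfectCodeIn : ∀ {p} (K H U A : Pred Carrier p) → Set (c ⊔ p)
  IsTotalPerfectCodeIn K H U A =
    ∀ g → K g →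
      (Σ[ a ∈ Carrier ] (A a × Adjacent U g a)) ×
      (∀ a a′ → A a → A a′ → Adjacent U g a → Adjacent U g a′ → SameCoset H a a′)

  IsTPCOfPair : ∀ {p} (K H A : Pred Carrier p) → Set (c ⊔ ℓ ⊔ suc p)
  IsTPCOfPair {p} K H A =
    Σ[ U ∈ Pred Carrier p ] (IsCosetGraphSet K H U × IsTotalPerfectCodeIn K H U A)

-- Restrict the connection set to L: if Cos(G,H,U) has A as a total perfect
-- code, so does Cos(L,H,U ∩ L). Intersecting with L keeps U a union of
-- H-double cosets because H ≤ L, and for g ∈ L the unique code neighbour aH
-- of gH stays adjacent, since g⁻¹a ∈ L as soon as a ∈ A ⊆ L.
module Submission where

open import Defs
open import Level using (Level)
open import Algebra.Bundles using (Group)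
open import Relation.Unary using (Pred; _⊆_; _∩_)
open import Data.Product using (_,_; proj₁; proj₂)

module _ {c ℓ p : Level} (G : Group c ℓ) where
  open Group G
  open import Algebra.Properties.Group G using (⁻¹-involutive)

  IsCosetGraphSet-∩ : {K H U L : Pred Carrier p} →
    IsSubgroup G L → H ⊆ L →
    IsCosetGraphSet G K H U → IsCosetGraphSet G L H (U ∩ L)
  IsCosetGraphSet-∩ sL H⊆L cs = record
    { resp     = λ x≈y (u , l) → U.resp x≈y u , L.resp x≈y l
    ; ⊆K       = proj₂
    ; double   = λ h (u , l) h′ →
                   U.double h u h′ , L.∙∈ (L.∙∈ (H⊆L h) l) (H⊆L h′)
    ; disjoint = λ h (u , _) → U.disjoint h u
    ; inv⊆     = λ (u , l) → U.inv⊆ u , L.⁻¹∈ l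
    ; inv⊇     = λ (u , l) → U.inv⊇ u , L.resp (⁻¹-involutive _) (L.⁻¹∈ l)
    }
    where
    module U = IsCosetGraphSet cs
    module L = IsSubgroup sL

  IsTotalPerfectCodeIn-∩ : {K H U A L : Pred Carrier p} →
    IsSubgroup G L → A ⊆ L → L ⊆ K →
    IsTotalPerfectCodeIn G K H U A → IsTotalPerfectCodeIn G L H (U ∩ L) A
  IsTotalPerfectCodeIn-∩ sL A⊆L L⊆K tpc g g∈L
    with (a , a∈A , g~a) , unique ← tpc g (L⊆K g∈L) =
    (a , a∈A , g~a , L.∙∈ (L.⁻¹∈ g∈L) (A⊆L a∈A)) ,
    λ a a′ a∈A a′∈A g~a g~a′ → unique a a′ a∈A a′∈A (proj₁ g~a) (proj₁ g~a′)
    where module L = IsSubgroup sL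

  IsTPCOfPair-mono : {K H A L : Pred Carrier p} →
    IsSubgroup G L → H ⊆ A → A ⊆ L → L ⊆ K →
    IsTPCOfPair G K H A → IsTPCOfPair G L H A
  IsTPCOfPair-mono {H = H} {L = L} sL H⊆A A⊆L L⊆K (U , cs , tpc) =
    U ∩ L ,
    IsCosetGraphSet-∩ sL (λ h → A⊆L (H⊆A h)) cs ,
    IsTotalPerfectCodeIn-∩ {H = H} {U = U} sL A⊆L L⊆K tpc

theorem4p3 : {c ℓ p : Level} (G : Group c ℓ) → IsFinite G →
    (H A L : Pred (Group.Carrier G) p) →
    IsSubgroup G H → IsSubgroup G A → IsSubgroup G L →
    H ⊆ A → A ⊆ L →
    IsTPCOfPair G (Full G) H A → IsTPCOfPair G L H A
theorem4p3 G _ H A L _ _ sL H⊆A A⊆L =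
  IsTPCOfPair-mono G sL H⊆A A⊆L _
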